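{- For each positive integer $k$, there is a connected chordal graph $H_k$ such that $\mathrm{mp}(H_k)=9k$ and $\gamma_b(H_k)=10k$.
   Context: All graphs are finite, simple and undirected. A graph is chordal if every cycle on at least four vertices has a chord. For a connected graph $G=(V,E)$, $d(u,v)$ is the shortest-path distance, $\mathrm{diam}(G)$ the diameter, $N_r[v]=\{u\in V: d(u,v)\le r\}$. A broadcast is a function $f:V\to\{0,1,\dots,\mathrm{diam}(G)\}$; it is dominating if for every $u\in V$ there is $v$ with $f(v)>0$ and $d(u,v)\le f(v)$; its cost is $\sum_v f(v)$; $\gamma_b(G)$ is the minimum cost of a dominating broadcast. A multipacking is a set $M\subseteq V$ with $|N_r[v]\cap M|\le r$ for all $v\in V$ and all integers $r\ge1$; $\mathrm{mp}(G)$ is the maximum size of a multipacking. -}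

module Defs where

open import Data.Nat using (ℕ; zero; suc; _+_; _≤_; _<_; _%_)
open import Data.Bool using (Bool; true; false; _∧_; _∨_)
open import Data.Fin using (Fin) renaming (_≟_ to _≟ᶠ_)
open import Data.Fin.Subset using (Subset; _∩_; ∣_∣)
open import Data.Vec using (tabulate)
open import Data.List using (List; allFin; map)
open import Data.Bool.ListAction using (any)
open import Data.Nat.ListAction using (sum)
open import Data.Product using (Σ; ∃; _×_; ∃-syntax)
open import Relation.Nullary using (¬_; does)
open import Relation.Binary.PropositionalEquality using (_≡_)

record Graph : Set where
  field
    n     : ℕ
    adj   : Fin n → Fin n → Bool
    sym   : ∀ u v → adj u v ≡ adj v u
    irrefl : ∀ v → adj v v ≡ false

open Graph public

V : Graph → Set
V G = Fin (n G)

within : (G : Graph) → ℕ → V G → V G → Bool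
within G zero    u v = does (u ≟ᶠ v)
within G (suc r) u v = within G r u v ∨ any (λ w → adj G u w ∧ within G r w v) (allFin (n G))

Connected : Graph → Set
Connected G = ∀ (u v : V G) → ∃[ r ] (within G r u v ≡ true)

Dist : (G : Graph) → V G → V G → ℕ → Set
Dist G u v d = (within G d u v ≡ true) × (∀ e → within G e u v ≡ true → d ≤ e)

IsDiam : Graph → ℕ → Set
IsDiam G D = (∀ (x y : V G) → within G D x y ≡ true) × (∃[ x ] ∃[ y ] Dist G x y D)

record Cycle (G : Graph) (m : ℕ) : Set where
  field
    c      : ℕ → V G
    inj    : ∀ i j → i < 4 + m → j < 4 + m → c i ≡ c j → i ≡ j
    edges  : ∀ i → i < 4 + m → adj G (c i) (c (suc i % (4 + m))) ≡ true

HasChord : {G : Graph} {m : ℕ} → Cycle G m → Set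
HasChord {G} {m} C = ∃[ i ] ∃[ j ] (i < 4 + m × j < 4 + m
  × adj G (c i) (c j) ≡ true
  × ¬ (j ≡ suc i % (4 + m)) × ¬ (i ≡ suc j % (4 + m)))
  where open Cycle C

Chordal : Graph → Set
Chordal G = ∀ m (C : Cycle G m) → HasChord C

IsBroadcast : (G : Graph) → (V G → ℕ) → Set
IsBroadcast G f = ∀ D → IsDiam G D → ∀ v → f v ≤ D

IsDominatingBroadcast : (G : Graph) → (V G → ℕ) → Set
IsDominatingBroadcast G f = IsBroadcast G f ×
  (∀ (u : V G) → ∃[ v ] (0 < f v × within G (f v) u v ≡ true))

cost : (G : Graph) → (V G → ℕ) → ℕ
cost G f = sum (map f (allFin (n G)))

BroadcastDominationNumber : Graph → ℕ → Set
BroadcastDominationNumber G b =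
  (∃[ f ] (IsDominatingBroadcast G f × cost G f ≡ b))
  × (∀ f → IsDominatingBroadcast G f → b ≤ cost G f)

ball : (G : Graph) → ℕ → V G → Subset (n G)
ball G r v = tabulate (λ u → within G r u v)

IsMultipacking : (G : Graph) → Subset (n G) → Set
IsMultipacking G M = ∀ (v : V G) (r : ℕ) → 1 ≤ r → ∣ ball G r v ∩ M ∣ ≤ r

MultipackingNumber : Graph → ℕ → Set
MultipackingNumber G p =
  (∃[ M ] (IsMultipacking G M × ∣ M ∣ ≡ p))
  × (∀ M → IsMultipacking G M → ∣ M ∣ ≤ p)

{-# OPTIONS --safe #-}

-- H K is a chain of K blocks of 36 vertices: three "suns" (vertices z, x, a, b, c, y) followed by
-- a path p₀ … p₁₇ whose end is joined to the next block.  The later neighbours of every vertex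
-- form a clique, so H K is chordal.  A 1-Lipschitz height function, rising by 27 per block,
-- confines every ball of radius r to 2r + 1 consecutive heights.  The nine vertices per block of M
-- sit at distinct heights that are multiples of 3, so a ball of radius r ≥ 1 contains at most r of
-- them and M is a multipacking of size 9K; conversely each block splits into nine sets any two
-- members of which lie in a common closed neighbourhood, and a multipacking meets each such set at
-- most once.  Finally a set W of 20 vertices per
-- block meets every ball of radius r ≥ 1 in at most 2r vertices (through the height window when
-- r ≥ 4, and with two more Lipschitz potentials when r ≤ 3), so W/2 is a fractional multipacking
-- and every dominating broadcast costs at least 10K.
module Submission where

open import Defs hiding (sym)

open import Data.Bool using (Bool; true; false; _∧_; _∨_; T; if_then_else_)
open import Data.Bool.ListAction using (any)
open import Data.Bool.Properties using (T-≡; ∨-comm) renaming (_≟_ to _≟ᵇ_)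
open import Data.Empty using (⊥-elim)
open import Data.Fin using (Fin; toℕ; fromℕ<)
  renaming (zero to fzero; suc to fsuc; _≟_ to _≟ᶠ_; _<_ to _<ᶠ_)
open import Data.Fin.Properties using (toℕ-injective; toℕ<n; toℕ-fromℕ<)
  renaming (suc-injective to fsuc-injective)
open import Data.Fin.Subset using (Subset; _∩_; ∣_∣)
open import Data.List using ([]; _∷_; allFin) renaming (tabulate to listTabulate)
open import Data.List.Membership.Propositional using (lose; find)
open import Data.List.Membership.Propositional.Properties using (∈-allFin)
open import Data.List.Properties using (map-tabulate)
open import Data.List.Relation.Unary.Any.Properties using (any⁺; any⁻)
open import Data.Nat
  using (ℕ; zero; suc; _+_; _*_; _∸_; _≤_; _<_; z≤n; s≤s; _≡ᵇ_; _≤ᵇ_; _<ᵇ_; _≟_; _≤?_; _<?_;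
         NonZero; nonZero)
open import Data.Nat.DivMod
  using (_%_; _/_; _mod_; [m+n]%n≡m%n; [m+kn]%n≡m%n; n%n≡0; m<n⇒m%n≡m; m%n<n; m%n%n≡m%n;
         %-distribˡ-+; m*n/n≡m; +-distrib-/-∣ʳ; m≡m%n+[m/n]*n; m<n⇒m/n≡0; m<n*o⇒m/o<n)
open import Data.Nat.Divisibility using (divides-refl)
open import Data.Nat.ListAction using () renaming (sum to listSum)
open import Data.Nat.Properties
open import Algebra.Properties.CommutativeMonoid.Sum +-0-commutativeMonoid
  using (sum; sum-syntax; ∑-comm; sum-cong-≗; sum-replicate-zero)
open import Algebra.Properties.CommutativeSemigroup +-commutativeSemigroup
  using (x∙yz≈y∙xz; x∙yz≈z∙xy; xy∙z≈y∙xz; xy∙z≈xz∙y)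
open import Data.List.Membership.DecPropositional _≟_ using (_∈?_)
open import Data.Product using (∃-syntax; _×_; _,_; proj₁; proj₂)
open import Data.Sum using (_⊎_; inj₁; inj₂; [_,_]′)
open import Data.Vec using (Vec; []; _∷_; tabulate; lookup)
open import Function using (_∘_; Equivalence)
open import Relation.Binary.Definitions using (tri<; tri≈; tri>)
open import Relation.Binary.PropositionalEquality
  using (_≡_; _≢_; ≢-sym; refl; sym; trans; cong; cong₂; subst; subst₂; module ≡-Reasoning)
open import Relation.Nullary using (¬_; Dec; yes; no; does)
open import Relation.Nullary.Decidable using (dec-true; from-yes; _×-dec_; _⊎-dec_; _→-dec_; ¬?)

T⇒true : ∀ {b} → T b → b ≡ true
T⇒true = Equivalence.to T-≡

true⇒T : ∀ {b} → b ≡ true → T b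
true⇒T = Equivalence.from T-≡

∧-intro : ∀ {a b} → a ≡ true → b ≡ true → a ∧ b ≡ true
∧-intro refl refl = refl

∧-elimˡ : ∀ {a b} → a ∧ b ≡ true → a ≡ true
∧-elimˡ {true} _ = refl

∧-elimʳ : ∀ {a b} → a ∧ b ≡ true → b ≡ true
∧-elimʳ {true} e = e

∨-introˡ : ∀ {a} b → a ≡ true → a ∨ b ≡ true
∨-introˡ b refl = refl

∨-introʳ : ∀ a {b} → b ≡ true → a ∨ b ≡ true
∨-introʳ true  _ = refl
∨-introʳ false e = e

∨-elim : ∀ {a b} → a ∨ b ≡ true → a ≡ true ⊎ b ≡ true
∨-elim {true}  _ = inj₁ refl
∨-elim {false} e = inj₂ e

≡ᵇ-sound : ∀ {m n} → (m ≡ᵇ n) ≡ true → m ≡ n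
≡ᵇ-sound {m} {n} e = ≡ᵇ⇒≡ m n (true⇒T e)

≡ᵇ-complete : ∀ {m n} → m ≡ n → (m ≡ᵇ n) ≡ true
≡ᵇ-complete {m} {n} e = T⇒true (≡⇒≡ᵇ m n e)

≤ᵇ-sound : ∀ {m n} → (m ≤ᵇ n) ≡ true → m ≤ n
≤ᵇ-sound {m} {n} e = ≤ᵇ⇒≤ m n (true⇒T e)

≤ᵇ-complete : ∀ {m n} → m ≤ n → (m ≤ᵇ n) ≡ true
≤ᵇ-complete m≤n = T⇒true (≤⇒≤ᵇ m≤n)

<ᵇ-complete : ∀ {m n} → m < n → (m <ᵇ n) ≡ true
<ᵇ-complete m<n = T⇒true (<⇒<ᵇ m<n)

bool-ext : ∀ {b c} → (b ≡ true → c ≡ true) → (c ≡ true → b ≡ true) → b ≡ c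
bool-ext {true}  {true}  _ _ = refl
bool-ext {true}  {false} b⇒c _ = sym (b⇒c refl)
bool-ext {false} {true}  _ c⇒b = c⇒b refl
bool-ext {false} {false} _ _ = refl

≤ᵇ-shift : ∀ a x y → (a + x ≤ᵇ a + y) ≡ (x ≤ᵇ y)
≤ᵇ-shift a x y = bool-ext (λ e → ≤ᵇ-complete (+-cancelˡ-≤ a x y (≤ᵇ-sound e)))
                         (λ e → ≤ᵇ-complete (+-monoʳ-≤ a (≤ᵇ-sound e)))

𝟙 : Bool → ℕ
𝟙 b = if b then 1 else 0

𝟙-true : ∀ {b} → b ≡ true → 𝟙 b ≡ 1
𝟙-true refl = refl

𝟙-false : ∀ {b} → ¬ (b ≡ true) → 𝟙 b ≡ 0
𝟙-false {true}  b≢true = ⊥-elim (b≢true refl)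
𝟙-false {false} _      = refl

𝟙≤ : ∀ {b x} → (b ≡ true → 1 ≤ x) → 𝟙 b ≤ x
𝟙≤ {false} _ = z≤n
𝟙≤ {true}  h = h refl

∑-mono-≤ : ∀ {n} {f g : Fin n → ℕ} → (∀ i → f i ≤ g i) → sum f ≤ sum g
∑-mono-≤ {zero}  _   = z≤n
∑-mono-≤ {suc n} f≤g = +-mono-≤ (f≤g fzero) (∑-mono-≤ (f≤g ∘ fsuc))

term≤∑ : ∀ {n} (f : Fin n → ℕ) i → f i ≤ sum f
term≤∑ f fzero    = m≤m+n (f fzero) _
term≤∑ f (fsuc i) = ≤-trans (term≤∑ (f ∘ fsuc) i) (m≤n+m _ (f fzero))

pair≤∑ : ∀ {n} (f : Fin n → ℕ) {i j} → i ≢ j → f i + f j ≤ sum f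
pair≤∑ f {fzero}  {fzero}  i≢j = ⊥-elim (i≢j refl)
pair≤∑ f {fzero}  {fsuc j} _   = +-monoʳ-≤ (f fzero) (term≤∑ (f ∘ fsuc) j)
pair≤∑ f {fsuc i} {fzero}  _   =
  subst (_≤ sum f) (+-comm (f fzero) (f (fsuc i))) (+-monoʳ-≤ (f fzero) (term≤∑ (f ∘ fsuc) i))
pair≤∑ f {fsuc i} {fsuc j} i≢j =
  ≤-trans (pair≤∑ (f ∘ fsuc) (i≢j ∘ cong fsuc)) (m≤n+m _ (f fzero))

∑-const : ∀ n c → ∑[ i < n ] c ≡ n * c
∑-const zero    c = refl
∑-const (suc n) c = cong (c +_) (∑-const n c)

∑-*ˡ : ∀ {n} c (f : Fin n → ℕ) → ∑[ i < n ] (c * f i) ≡ c * sum f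
∑-*ˡ {zero}  c f = sym (*-zeroʳ c)
∑-*ˡ {suc n} c f = trans (cong (c * f fzero +_) (∑-*ˡ c (f ∘ fsuc))) (sym (*-distribˡ-+ c (f fzero) _))

∑-split : ∀ m n (h : ℕ → ℕ) →
          ∑[ t < m + n ] h (toℕ t) ≡ ∑[ t < m ] h (toℕ t) + ∑[ t < n ] h (m + toℕ t)
∑-split zero    n h = refl
∑-split (suc m) n h = trans (cong (h 0 +_) (∑-split m n (h ∘ suc))) (sym (+-assoc (h 0) _ _))

∑-blocks : ∀ K b (h : ℕ → ℕ) →
           ∑[ i < K * b ] h (toℕ i) ≡ ∑[ q < K ] ∑[ s < b ] h (toℕ s + toℕ q * b)
∑-blocks zero    b h = refl
∑-blocks (suc K) b h = begin
  ∑[ i < b + K * b ] h (toℕ i)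
    ≡⟨ ∑-split b (K * b) h ⟩
  ∑[ s < b ] h (toℕ s) + ∑[ i < K * b ] h (b + toℕ i)
    ≡⟨ cong₂ _+_ (sum-cong-≗ {b} (λ s → cong h (sym (+-identityʳ (toℕ s)))))
                 (∑-blocks K b (λ i → h (b + i))) ⟩
  ∑[ s < b ] h (toℕ s + 0) + ∑[ q < K ] ∑[ s < b ] h (b + (toℕ s + toℕ q * b))
    ≡⟨ cong (∑[ s < b ] h (toℕ s + 0) +_)
            (sum-cong-≗ {K} (λ q → sum-cong-≗ {b} (λ s → cong h (x∙yz≈y∙xz b (toℕ s) (toℕ q * b))))) ⟩
  ∑[ q < suc K ] ∑[ s < b ] h (toℕ s + toℕ q * b) ∎
  where open ≡-Reasoning

∑-zero : ∀ {n} (f : Fin n → ℕ) → (∀ i → f i ≡ 0) → sum f ≡ 0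
∑-zero {n} f f≡0 = trans (sum-cong-≗ f≡0) (sum-replicate-zero n)

∑𝟙≤1 : ∀ {n} (b : Fin n → Bool) → (∀ i j → b i ≡ true → b j ≡ true → i ≡ j) →
       ∑[ i < n ] 𝟙 (b i) ≤ 1
∑𝟙≤1 {zero}  b unique = z≤n
∑𝟙≤1 {suc n} b unique with b fzero in b₀
... | true  = ≤-reflexive (cong suc (∑-zero (𝟙 ∘ b ∘ fsuc)
                (λ i → 𝟙-false (λ bi → fzero≢fsuc (unique fzero (fsuc i) b₀ bi)))))
  where
  fzero≢fsuc : ∀ {i : Fin n} → fzero ≢ fsuc i
  fzero≢fsuc ()
... | false = ∑𝟙≤1 (b ∘ fsuc) (λ i j bi bj → fsuc-injective (unique (fsuc i) (fsuc j) bi bj))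

∑𝟙≤𝟙 : ∀ {n} (b : Fin n → Bool) c → (∀ i j → b i ≡ true → b j ≡ true → i ≡ j) →
       (∀ i → b i ≡ true → c ≡ true) → ∑[ i < n ] 𝟙 (b i) ≤ 𝟙 c
∑𝟙≤𝟙 b true  unique _ = ∑𝟙≤1 b unique
∑𝟙≤𝟙 b false _ implies = ≤-reflexive (∑-zero (𝟙 ∘ b) (λ i → 𝟙-false (λ bi → false≢true (implies i bi))))
  where
  false≢true : false ≢ true
  false≢true ()

∣tabulate∣ : ∀ {n} (f : Fin n → Bool) → ∣ tabulate f ∣ ≡ ∑[ i < n ] 𝟙 (f i)
∣tabulate∣ {zero}  f = refl
∣tabulate∣ {suc n} f with f fzero
... | true  = cong suc (∣tabulate∣ (f ∘ fsuc))
... | false = ∣tabulate∣ (f ∘ fsuc)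

tabulate-∩ : ∀ {n} (f g : Fin n → Bool) → tabulate f ∩ tabulate g ≡ tabulate (λ i → f i ∧ g i)
tabulate-∩ {zero}  f g = refl
tabulate-∩ {suc n} f g = cong (f fzero ∧ g fzero ∷_) (tabulate-∩ (f ∘ fsuc) (g ∘ fsuc))

tabulate-lookup : ∀ {n} (M : Subset n) → tabulate (lookup M) ≡ M
tabulate-lookup []      = refl
tabulate-lookup (x ∷ M) = cong (x ∷_) (tabulate-lookup M)

∣subset∣ : ∀ {n} (M : Subset n) → ∣ M ∣ ≡ ∑[ i < n ] 𝟙 (lookup M i)
∣subset∣ M = trans (cong ∣_∣ (sym (tabulate-lookup M))) (∣tabulate∣ (lookup M))

listSum-tabulate : ∀ {n} (f : Fin n → ℕ) → listSum (listTabulate f) ≡ sum f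
listSum-tabulate {zero}  f = refl
listSum-tabulate {suc n} f = cong (f fzero +_) (listSum-tabulate (f ∘ fsuc))

cost≡∑ : ∀ G (f : V G → ℕ) → cost G f ≡ ∑[ u < n G ] f u
cost≡∑ G f = trans (cong listSum (map-tabulate (λ u → u) f)) (listSum-tabulate f)

any-allFin⁺ : ∀ {m} (p : Fin m → Bool) i → p i ≡ true → any p (allFin m) ≡ true
any-allFin⁺ p i e = T⇒true (any⁺ p (lose (∈-allFin i) (true⇒T e)))

any-allFin⁻ : ∀ {m} (p : Fin m → Bool) → any p (allFin m) ≡ true → ∃[ i ] (p i ≡ true)
any-allFin⁻ p e with find (any⁻ p (allFin _) (true⇒T e))
... | i , _ , pi = i , T⇒true pi

module Walks (G : Graph) where

  within-refl : ∀ r (v : V G) → within G r v v ≡ true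
  within-refl zero    v = dec-true (v ≟ᶠ v) refl
  within-refl (suc r) v = ∨-introˡ _ (within-refl r v)

  within-zero : ∀ {u v : V G} → within G 0 u v ≡ true → u ≡ v
  within-zero {u} {v} e with u ≟ᶠ v
  ... | yes u≡v = u≡v

  within-suc : ∀ r {u v : V G} → within G r u v ≡ true → within G (suc r) u v ≡ true
  within-suc r = ∨-introˡ _

  within-step : ∀ r {u w v : V G} → adj G u w ≡ true → within G r w v ≡ true →
                within G (suc r) u v ≡ true
  within-step r {u} {w} {v} uw wv =
    ∨-introʳ (within G r u v) (any-allFin⁺ (λ x → adj G u x ∧ within G r x v) w (∧-intro uw wv))

  within-unstep : ∀ r {u v : V G} → within G (suc r) u v ≡ true →
                  within G r u v ≡ true ⊎ ∃[ w ] (adj G u w ≡ true × within G r w v ≡ true)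
  within-unstep r {u} {v} e with ∨-elim {within G r u v} e
  ... | inj₁ uv = inj₁ uv
  ... | inj₂ step with any-allFin⁻ (λ x → adj G u x ∧ within G r x v) step
  ...   | w , uwv = inj₂ (w , ∧-elimˡ uwv , ∧-elimʳ {adj G u w} uwv)

  within-trans : ∀ a b {u w v : V G} → within G a u w ≡ true → within G b w v ≡ true →
                 within G (a + b) u v ≡ true
  within-trans zero b {u} {w} uw wv with within-zero {u} {w} uw
  ... | refl = wv
  within-trans (suc a) b uw wv with within-unstep a uw
  ... | inj₁ uw′           = within-suc (a + b) (within-trans a b uw′ wv)
  ... | inj₂ (x , ux , xw) = within-step (a + b) ux (within-trans a b xw wv)

  within-sym : ∀ r {u v : V G} → within G r u v ≡ true → within G r v u ≡ true
  within-sym zero {u} {v} uv with within-zero {u} {v} uv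
  ... | refl = within-refl 0 u
  within-sym (suc r) {u} {v} uv with within-unstep r uv
  ... | inj₁ uv′         = within-suc r (within-sym r uv′)
  ... | inj₂ (w , uw , wv) = subst (λ t → within G t v u ≡ true) (+-comm r 1)
    (within-trans r 1 (within-sym r wv) (within-step 0 (trans (Graph.sym G w u) uw) (within-refl 0 u)))

  -- Adjacency is symmetric, so this bounds |φ u - φ w| by 1 along every edge.
  Lipschitz : (V G → ℕ) → Set
  Lipschitz φ = ∀ u w → adj G u w ≡ true → φ u ≤ suc (φ w)

  within-lipschitz : ∀ {φ : V G → ℕ} → Lipschitz φ → ∀ r {u v : V G} →
                     within G r u v ≡ true → φ u ≤ φ v + r × φ v ≤ φ u + r
  within-lipschitz {φ} lip zero {u} {v} uv with within-zero {u} {v} uv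
  ... | refl = ≤-reflexive (sym (+-identityʳ (φ u))) , ≤-reflexive (sym (+-identityʳ (φ u)))
  within-lipschitz {φ} lip (suc r) {u} {v} uv with within-unstep r uv
  ... | inj₁ uv′ = let (p , q) = within-lipschitz lip r uv′ in
    ≤-trans p (+-monoʳ-≤ (φ v) (n≤1+n r)) , ≤-trans q (+-monoʳ-≤ (φ u) (n≤1+n r))
  ... | inj₂ (w , uw , wv) = let (p , q) = within-lipschitz lip r wv in
    ≤-trans (lip u w uw) (≤-reflexive-suc p) ,
    ≤-trans q (≤-trans (+-monoˡ-≤ r (lip w u (trans (Graph.sym G w u) uw)))
                       (≤-reflexive (sym (+-suc (φ u) r))))
    where
    ≤-reflexive-suc : ∀ {x y} → x ≤ y + r → suc x ≤ y + suc r
    ≤-reflexive-suc {x} {y} h = subst (suc x ≤_) (sym (+-suc y r)) (s≤s h)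

HasForwardNeighbours : Graph → Set
HasForwardNeighbours G =
  ∀ (u : V G) → suc (toℕ u) < n G → ∃[ w ] (u <ᶠ w × adj G u w ≡ true)

module _ (G : Graph) (forward : HasForwardNeighbours G) where
  open Walks G

  climb : ∀ d (u : V G) → n G ≤ toℕ u + d →
          ∃[ t ] (suc (toℕ t) ≡ n G × ∃[ r ] (within G r u t ≡ true))
  climb d u h with suc (toℕ u) <? n G
  ... | no ¬lt = u , ≤-antisym (toℕ<n u) (≮⇒≥ ¬lt) , 0 , within-refl 0 u
  climb zero u h | yes lt =
    ⊥-elim (<-irrefl refl (<-≤-trans (<-trans (n<1+n _) lt) (≤-trans h (≤-reflexive (+-identityʳ _)))))
  climb (suc d) u h | yes lt with forward u lt
  ... | w , u<w , uw with climb d w (≤-trans h (≤-trans (≤-reflexive (+-suc (toℕ u) d)) (+-monoˡ-≤ d u<w)))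
  ...   | t , t-last , r , wt = t , t-last , suc r , within-step r uw wt

  forward⇒connected : Connected G
  forward⇒connected u v with climb (n G) u (m≤n+m _ _) | climb (n G) v (m≤n+m _ _)
  ... | t , t-last , r , ut | t′ , t′-last , r′ , vt′
    with toℕ-injective (suc-injective (trans t-last (sym t′-last)))
  ... | refl = r + r′ , within-trans r r′ ut (within-sym r′ vt′)

IsPerfectEliminationOrder : Graph → Set
IsPerfectEliminationOrder G = ∀ {u w₁ w₂ : V G} → adj G u w₁ ≡ true → adj G u w₂ ≡ true →
  u <ᶠ w₁ → u <ᶠ w₂ → w₁ ≢ w₂ → adj G w₁ w₂ ≡ true

argmin : (g : ℕ → ℕ) (L : ℕ) → ∃[ i ] (i < suc L × (∀ j → j < suc L → g i ≤ g j))
argmin g zero = 0 , s≤s z≤n , λ { zero _ → ≤-refl ; (suc j) (s≤s ()) }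
argmin g (suc L) with argmin g L
... | i , i<1+L , i-min with g i ≤? g (suc L)
...   | yes gi≤ = i , m<n⇒m<1+n i<1+L ,
          λ j j< → [ i-min j , (λ { refl → gi≤ }) ]′ (m<1+n⇒m<n∨m≡n j<)
...   | no gi≰ = suc L , ≤-refl ,
          λ j j< → [ (λ j<1+L → ≤-trans (<⇒≤ (≰⇒> gi≰)) (i-min j j<1+L)) , (λ { refl → ≤-refl }) ]′
                   (m<1+n⇒m<n∨m≡n j<)

module _ {G : Graph} (peo : IsPerfectEliminationOrder G) {m} (C : Cycle G m) where
  open Cycle C

  neighbours-of-minimum-adjacent : ∀ {i₀ p q} → i₀ < 4 + m → p < 4 + m → q < 4 + m →
    p ≢ i₀ → q ≢ i₀ → p ≢ q → (∀ j → j < 4 + m → toℕ (c i₀) ≤ toℕ (c j)) →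
    adj G (c p) (c i₀) ≡ true → adj G (c i₀) (c q) ≡ true → adj G (c p) (c q) ≡ true
  neighbours-of-minimum-adjacent {i₀} {p} {q} i₀< p< q< p≢i₀ q≢i₀ p≢q i₀-min pi₀ i₀q =
    peo (trans (Graph.sym G (c i₀) (c p)) pi₀) i₀q (later p< p≢i₀) (later q< q≢i₀)
        (λ e → p≢q (inj p q p< q< e))
    where
    later : ∀ {j} → j < 4 + m → j ≢ i₀ → c i₀ <ᶠ c j
    later {j} j< j≢i₀ = ≤∧≢⇒< (i₀-min j j<) (λ e → j≢i₀ (sym (inj i₀ j i₀< j< (toℕ-injective e))))

  cycle-wraps : suc (3 + m) % (4 + m) ≡ 0
  cycle-wraps = n%n≡0 (4 + m)

  peo⇒chord : HasChord C
  peo⇒chord with argmin (λ i → toℕ (c i)) (3 + m)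
  ... | zero , i₀< , i₀-min =
    3 + m , 1 , ≤-refl , s≤s (s≤s z≤n) ,
    neighbours-of-minimum-adjacent i₀< ≤-refl (s≤s (s≤s z≤n)) (λ ()) (λ ()) (λ ()) i₀-min
      (subst (λ x → adj G (c (3 + m)) (c x) ≡ true) cycle-wraps (edges (3 + m) ≤-refl))
      (edges 0 (s≤s z≤n)) ,
    (λ e → 1≢0 (trans e cycle-wraps)) , λ ()
    where 1≢0 : 1 ≢ 0
          1≢0 ()
  ... | suc i , i₀< , i₀-min with m<1+n⇒m<n∨m≡n i₀<
  ...   | inj₁ i₀<3+m =
    i , 2 + i , <-trans (n<1+n i) i₀< , s≤s i₀<3+m ,
    neighbours-of-minimum-adjacent i₀< (<-trans (n<1+n i) i₀<) (s≤s i₀<3+m)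
      (<⇒≢ (n<1+n i)) (≢-sym (<⇒≢ (n<1+n (suc i)))) (<⇒≢ (m<2+m i)) i₀-min
      (subst (λ x → adj G (c i) (c x) ≡ true) (m<n⇒m%n≡m i₀<) (edges i (<-trans (n<1+n i) i₀<)))
      (subst (λ x → adj G (c (suc i)) (c x) ≡ true) (m<n⇒m%n≡m (s≤s i₀<3+m)) (edges (suc i) i₀<)) ,
    (λ e → <⇒≢ (n<1+n (suc i)) (sym (trans e (m<n⇒m%n≡m i₀<)))) ,
    not-after
    where
    m<2+m : ∀ x → x < 2 + x
    m<2+m x = <-trans (n<1+n x) (n<1+n (suc x))
    not-after : i ≢ (3 + i) % (4 + m)
    not-after e with m≤n⇒m<n∨m≡n (s≤s i₀<3+m)
    ... | inj₁ 3+i<L = <⇒≢ (<-trans (m<2+m i) (n<1+n (2 + i))) (trans e (m<n⇒m%n≡m 3+i<L))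
    ... | inj₂ 3+i≡L with trans e (trans (cong (_% (4 + m)) 3+i≡L) cycle-wraps)
    ...   | refl = 3≢4+m 3+i≡L
      where 3≢4+m : 3 ≢ 4 + m
            3≢4+m ()
  ...   | inj₂ refl =
    2 + m , 0 , n≤1+n (3 + m) , s≤s z≤n ,
    neighbours-of-minimum-adjacent i₀< (n≤1+n (3 + m)) (s≤s z≤n) (<⇒≢ (n<1+n (2 + m))) (λ ()) (λ ()) i₀-min
      (subst (λ x → adj G (c (2 + m)) (c x) ≡ true) (m<n⇒m%n≡m ≤-refl) (edges (2 + m) (n≤1+n (3 + m))))
      (subst (λ x → adj G (c (3 + m)) (c x) ≡ true) cycle-wraps (edges (3 + m) ≤-refl)) ,
    (λ e → 0≢3+m (trans e (m<n⇒m%n≡m ≤-refl))) , λ ()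
    where 0≢3+m : 0 ≢ 3 + m
          0≢3+m ()

peo⇒chordal : ∀ {G} → IsPerfectEliminationOrder G → Chordal G
peo⇒chordal peo m C = peo⇒chord peo C

∣ball∩tabulate∣ : ∀ G r v (P : V G → Bool) →
                  ∣ ball G r v ∩ tabulate P ∣ ≡ ∑[ u < n G ] 𝟙 (within G r u v ∧ P u)
∣ball∩tabulate∣ G r v P = trans (cong ∣_∣ (tabulate-∩ (λ u → within G r u v) P))
                                  (∣tabulate∣ (λ u → within G r u v ∧ P u))

∣ball∩∣ : ∀ G r v (M : Subset (n G)) →
          ∣ ball G r v ∩ M ∣ ≡ ∑[ u < n G ] 𝟙 (within G r u v ∧ lookup M u)
∣ball∩∣ G r v M = trans (cong (λ X → ∣ ball G r v ∩ X ∣) (sym (tabulate-lookup M)))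
                        (∣ball∩tabulate∣ G r v (lookup M))

multipacking-closedNeighbourhood : ∀ G {M} → IsMultipacking G M → ∀ {u w c : V G} →
  lookup M u ≡ true → lookup M w ≡ true → within G 1 u c ≡ true → within G 1 w c ≡ true → u ≡ w
multipacking-closedNeighbourhood G {M} multipacking {u} {w} {c} Mu Mw uc wc with u ≟ᶠ w
... | yes u≡w = u≡w
... | no u≢w = ⊥-elim (<-irrefl refl (begin-strict
  1                      <⟨ n<1+n 1 ⟩
  2                      ≡⟨ sym two ⟩
  𝟙 (f u) + 𝟙 (f w)     ≤⟨ pair≤∑ (𝟙 ∘ f) u≢w ⟩
  ∑[ x < n G ] 𝟙 (f x)  ≡⟨ sym (∣ball∩∣ G 1 c M) ⟩
  ∣ ball G 1 c ∩ M ∣     ≤⟨ multipacking c 1 ≤-refl ⟩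
  1                      ∎))
  where
  open ≤-Reasoning
  f : V G → Bool
  f x = within G 1 x c ∧ lookup M x
  two : 𝟙 (f u) + 𝟙 (f w) ≡ 2
  two = cong₂ _+_ (𝟙-true (∧-intro uc Mu)) (𝟙-true (∧-intro wc Mw))

-- Weak LP duality: W weighted by 1/c is a fractional multipacking.
broadcast-cost-lower-bound : ∀ G (W : V G → Bool) c →
  (∀ v r → 1 ≤ r → ∑[ u < n G ] 𝟙 (within G r u v ∧ W u) ≤ c * r) →
  ∀ f → IsDominatingBroadcast G f → ∑[ u < n G ] 𝟙 (W u) ≤ c * cost G f
broadcast-cost-lower-bound G W c ball-bound f (_ , dominating) = begin
  ∑[ u < n G ] 𝟙 (W u)                 ≤⟨ ∑-mono-≤ covered ⟩
  ∑[ u < n G ] ∑[ v < n G ] heard u v  ≡⟨ ∑-comm heard ⟩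
  ∑[ v < n G ] ∑[ u < n G ] heard u v  ≤⟨ ∑-mono-≤ per-broadcaster ⟩
  ∑[ v < n G ] (c * f v)               ≡⟨ ∑-*ˡ c f ⟩
  c * ∑[ v < n G ] f v                 ≡⟨ cong (c *_) (cost≡∑ G f) ⟨
  c * cost G f                         ∎
  where
  open ≤-Reasoning
  heard : V G → V G → ℕ
  heard u v = 𝟙 ((0 <ᵇ f v) ∧ within G (f v) u v ∧ W u)
  covered : ∀ u → 𝟙 (W u) ≤ ∑[ v < n G ] heard u v
  covered u = 𝟙≤ λ Wu → let (v , 0<fv , uv) = dominating u in
    ≤-trans (≤-reflexive (sym (𝟙-true (∧-intro (<ᵇ-complete 0<fv) (∧-intro uv Wu)))))
            (term≤∑ (heard u) v)
  per-broadcaster : ∀ v → ∑[ u < n G ] heard u v ≤ c * f v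
  per-broadcaster v with f v
  ... | zero  = ≤-reflexive (trans (sum-replicate-zero (n G)) (sym (*-zeroʳ c)))
  ... | suc r = ball-bound v (suc r) (s≤s z≤n)

-- Sums of a periodic sequence over windows

module Periodic (P : ℕ) .{{_ : NonZero P}} (p : ℕ → ℕ) where

  windowSum : ℕ → ℕ → ℕ
  windowSum a L = ∑[ t < L ] p ((a + toℕ t) % P)

  windowSum-mod : ∀ a L → windowSum a L ≡ windowSum (a % P) L
  windowSum-mod a L = sum-cong-≗ {L} λ t → cong p (begin
    (a + toℕ t) % P                   ≡⟨ %-distribˡ-+ a (toℕ t) P ⟩
    (a % P + toℕ t % P) % P           ≡⟨ cong (λ x → (x + toℕ t % P) % P) (m%n%n≡m%n a P) ⟨
    (a % P % P + toℕ t % P) % P       ≡⟨ %-distribˡ-+ (a % P) (toℕ t) P ⟨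
    (a % P + toℕ t) % P               ∎)
    where open ≡-Reasoning

  windowSum-period : ∀ a L → windowSum a (P + L) ≡ windowSum a P + windowSum a L
  windowSum-period a L = trans (∑-split P L (λ t → p ((a + t) % P)))
    (cong (windowSum a P +_) (sum-cong-≗ {L} λ t → cong p (trans
      (cong (_% P) (trans (x∙yz≈y∙xz a P (toℕ t)) (+-comm P (a + toℕ t))))
      ([m+n]%n≡m%n (a + toℕ t) P))))

  module _ (c d : ℕ) {T} (period≤T : ∀ {a} → a < P → windowSum a P ≤ T) (cT≤P : c * T ≤ P) where

    add-periods : ∀ {a y} → a < P → c * windowSum a y + d ≤ y →
                  ∀ q → c * windowSum a (q * P + y) + d ≤ q * P + y
    add-periods a<P base zero = base
    add-periods {a} {y} a<P base (suc q) =
      subst (λ z → c * windowSum a z + d ≤ z) (sym (+-assoc P (q * P) y)) (begin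
        c * windowSum a (P + (q * P + y)) + d
          ≡⟨ cong (λ s → c * s + d) (windowSum-period a (q * P + y)) ⟩
        c * (windowSum a P + windowSum a (q * P + y)) + d
          ≡⟨ cong (_+ d) (*-distribˡ-+ c (windowSum a P) _) ⟩
        c * windowSum a P + c * windowSum a (q * P + y) + d
          ≡⟨ +-assoc (c * windowSum a P) _ d ⟩
        c * windowSum a P + (c * windowSum a (q * P + y) + d)
          ≤⟨ +-mono-≤ (≤-trans (*-monoʳ-≤ c (period≤T a<P)) cT≤P) (add-periods a<P base q) ⟩
        P + (q * P + y) ∎)
      where open ≤-Reasoning

    -- A full period adds at most c·T ≤ P to the left side and exactly P to the right side.
    windowSum-bound : ∀ L₀ → (∀ {a} → a < P → ∀ {x} → x < P → c * windowSum a (L₀ + x) + d ≤ L₀ + x) →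
                      ∀ a L → L₀ ≤ L → c * windowSum a L + d ≤ L
    windowSum-bound L₀ base a L L₀≤L = begin
      c * windowSum a L + d                        ≡⟨ cong (λ s → c * s + d) (windowSum-mod a L) ⟩
      c * windowSum (a % P) L + d                  ≡⟨ cong (λ z → c * windowSum (a % P) z + d) L≡ ⟩
      c * windowSum (a % P) (q * P + (L₀ + x)) + d ≤⟨ add-periods a%P<P (base a%P<P (m%n<n (L ∸ L₀) P)) q ⟩
      q * P + (L₀ + x)                             ≡⟨ L≡ ⟨
      L                                            ∎
      where
      open ≤-Reasoning
      x q : ℕ
      x = (L ∸ L₀) % P
      q = (L ∸ L₀) / P
      a%P<P : a % P < P
      a%P<P = m%n<n a P
      L≡ : L ≡ q * P + (L₀ + x)
      L≡ = trans (sym (m+[n∸m]≡n L₀≤L))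
             (trans (cong (L₀ +_) (m≡m%n+[m/n]*n (L ∸ L₀) P)) (x∙yz≈z∙xy L₀ x (q * P)))

-- The graph H K

-- Vertex i of H K is the local vertex i % 36 of block i / 36.  Local vertices 6j, …, 6j + 5 are
-- z, x, a, b, c, y of the j-th sun and 18 + t is p_t; jumps d s says that local vertex s is
-- joined to the vertex d places later, which for s = 35 lies in the next block.
jumps : ℕ → ℕ → Bool
jumps 1 s = does (s ∈? (1 ∷ 2 ∷ 3 ∷ 4 ∷ 7 ∷ 8 ∷ 9 ∷ 10 ∷ 13 ∷ 14 ∷ 15 ∷ 16 ∷ 17 ∷ 18 ∷ 19 ∷ 20 ∷ 21 ∷ 22
                   ∷ 23 ∷ 24 ∷ 25 ∷ 26 ∷ 27 ∷ 28 ∷ 29 ∷ 30 ∷ 31 ∷ 32 ∷ 33 ∷ 34 ∷ []))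
jumps 2 s = does (s ∈? (0 ∷ 1 ∷ 2 ∷ 3 ∷ 5 ∷ 6 ∷ 7 ∷ 8 ∷ 9 ∷ 11 ∷ 12 ∷ 13 ∷ 14 ∷ 15 ∷ 35 ∷ []))
jumps 4 s = does (s ∈? (0 ∷ 6 ∷ 12 ∷ []))
jumps _ _ = false

jumps-range : ∀ d s → jumps d s ≡ true → 0 < d × d < 5
jumps-range 1 s _ = s≤s z≤n , s≤s (s≤s z≤n)
jumps-range 2 s _ = s≤s z≤n , s≤s (s≤s (s≤s z≤n))
jumps-range 4 s _ = s≤s z≤n , s≤s (s≤s (s≤s (s≤s (s≤s z≤n))))
jumps-range 0 s ()
jumps-range 3 s ()
jumps-range (suc (suc (suc (suc (suc d))))) s ()

forward : ℕ → ℕ → Bool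
forward i j = (i <ᵇ j) ∧ jumps (j ∸ i) (i % 36)

adjacentℕ : ℕ → ℕ → Bool
adjacentℕ i j = forward i j ∨ forward j i

<ᵇ-irrefl : ∀ i → (i <ᵇ i) ≡ false
<ᵇ-irrefl zero    = refl
<ᵇ-irrefl (suc i) = <ᵇ-irrefl i

adjacentℕ-irrefl : ∀ i → adjacentℕ i i ≡ false
adjacentℕ-irrefl i rewrite <ᵇ-irrefl i = refl

H : ℕ → Graph
H K = record
  { n      = K * 36
  ; adj    = λ u w → adjacentℕ (toℕ u) (toℕ w)
  ; sym    = λ u w → ∨-comm (forward (toℕ u) (toℕ w)) (forward (toℕ w) (toℕ u))
  ; irrefl = λ v → adjacentℕ-irrefl (toℕ v)
  }

forward-elim : ∀ i j → forward i j ≡ true → ∃[ d ] (j ≡ d + i × jumps d (i % 36) ≡ true)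
forward-elim i j e =
  j ∸ i , sym (m∸n+n≡m (<⇒≤ (<ᵇ⇒< i j (true⇒T (∧-elimˡ e))))) , ∧-elimʳ {i <ᵇ j} e

forward-intro : ∀ d i → jumps d (i % 36) ≡ true → forward i (d + i) ≡ true
forward-intro d i J = ∧-intro (<ᵇ-complete (m<n+m i (proj₁ (jumps-range d (i % 36) J))))
  (subst (λ x → jumps x (i % 36) ≡ true) (sym (m+n∸n≡m d i)) J)

forward-shift : ∀ q i j → forward i j ≡ true → forward (i + q * 36) (j + q * 36) ≡ true
forward-shift q i j e with forward-elim i j e
... | d , refl , J = subst (λ x → forward (i + q * 36) x ≡ true) (sym (+-assoc d i (q * 36)))
  (forward-intro d (i + q * 36) (subst (λ x → jumps d x ≡ true) (sym ([m+kn]%n≡m%n i q 36)) J))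

adjacentℕ-shift : ∀ q i j → adjacentℕ i j ≡ true → adjacentℕ (i + q * 36) (j + q * 36) ≡ true
adjacentℕ-shift q i j e with ∨-elim {forward i j} e
... | inj₁ ij = ∨-introˡ _ (forward-shift q i j ij)
... | inj₂ ji = ∨-introʳ _ (forward-shift q j i ji)

adjacent⇒forward : ∀ i j → adjacentℕ i j ≡ true → i < j → forward i j ≡ true
adjacent⇒forward i j e i<j with ∨-elim {forward i j} e
... | inj₁ ij = ij
... | inj₂ ji with forward-elim j i ji
...   | d , refl , _ = ⊥-elim (<-irrefl refl (<-≤-trans i<j (m≤n+m j d)))

%-block : ∀ {n} .{{_ : NonZero n}} {s} q → s < n → (s + q * n) % n ≡ s
%-block {n} {s} q s<n = trans ([m+kn]%n≡m%n s q n) (m<n⇒m%n≡m s<n)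

/-block : ∀ {n} .{{_ : NonZero n}} {s} q → s < n → (s + q * n) / n ≡ q
/-block {n} {s} q s<n = trans (+-distrib-/-∣ʳ s (divides-refl q)) (cong₂ _+_ (m<n⇒m/n≡0 s<n) (m*n/n≡m q n))

block< : ∀ {n K s q} → s < n → q < K → s + q * n < K * n
block< {n} {K} {s} {q} s<n q<K = ≤-trans (+-monoˡ-< (q * n) s<n) (*-monoˡ-≤ n q<K)

[m+n%d]%d≡[m+n]%d : ∀ m n d .{{_ : NonZero d}} → (m + n % d) % d ≡ (m + n) % d
[m+n%d]%d≡[m+n]%d m n d = sym (begin
  (m + n) % d                      ≡⟨ cong (λ x → (m + x) % d) (m≡m%n+[m/n]*n n d) ⟩
  (m + (n % d + n / d * d)) % d    ≡⟨ cong (_% d) (+-assoc m (n % d) _) ⟨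
  (m + n % d + n / d * d) % d      ≡⟨ [m+kn]%n≡m%n (m + n % d) (n / d) d ⟩
  (m + n % d) % d                  ∎)
  where open ≡-Reasoning

-- Facts verified by evaluation are kept opaque: unfolding them at a use site would re-run the
-- decision procedure on open terms.
opaque
  next-jump : ∀ {s} → s < 36 → jumps 1 s ≡ true ⊎ (jumps 2 s ≡ true × s ≢ 34)
  next-jump = from-yes (allUpTo? (λ s → (jumps 1 s ≟ᵇ true) ⊎-dec ((jumps 2 s ≟ᵇ true) ×-dec ¬? (s ≟ 34))) 36)

opaque
  jump-pairs : ∀ {s} → s < 36 → ∀ {d₁} → d₁ < 5 → ∀ {d₂} → d₂ < 5 → d₁ < d₂ →
               jumps d₁ s ≡ true → jumps d₂ s ≡ true → jumps (d₂ ∸ d₁) ((d₁ + s) % 36) ≡ true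
  jump-pairs = from-yes (allUpTo? (λ s → allUpTo? (λ d₁ → allUpTo? (λ d₂ →
    (d₁ <? d₂) →-dec (jumps d₁ s ≟ᵇ true) →-dec (jumps d₂ s ≟ᵇ true) →-dec
    (jumps (d₂ ∸ d₁) ((d₁ + s) % 36) ≟ᵇ true)) 5) 5) 36)

forward-clique : ∀ {d₁ d₂} i → d₁ < d₂ → jumps d₁ (i % 36) ≡ true → jumps d₂ (i % 36) ≡ true →
                 forward (d₁ + i) (d₂ + i) ≡ true
forward-clique {d₁} {d₂} i d₁<d₂ J₁ J₂ =
  subst (λ x → forward (d₁ + i) x ≡ true) d₂+i (forward-intro (d₂ ∸ d₁) (d₁ + i) J)
  where
  J : jumps (d₂ ∸ d₁) ((d₁ + i) % 36) ≡ true
  J = subst (λ x → jumps (d₂ ∸ d₁) x ≡ true) ([m+n%d]%d≡[m+n]%d d₁ i 36)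
        (jump-pairs (m%n<n i 36) (proj₂ (jumps-range d₁ _ J₁)) (proj₂ (jumps-range d₂ _ J₂)) d₁<d₂ J₁ J₂)
  d₂+i : d₂ ∸ d₁ + (d₁ + i) ≡ d₂ + i
  d₂+i = trans (sym (+-assoc (d₂ ∸ d₁) d₁ i)) (cong (_+ i) (m∸n+n≡m (<⇒≤ d₁<d₂)))

H-peo : ∀ K → IsPerfectEliminationOrder (H K)
H-peo K {u} {w₁} {w₂} uw₁ uw₂ u<w₁ u<w₂ w₁≢w₂
  with forward-elim (toℕ u) (toℕ w₁) (adjacent⇒forward _ _ uw₁ u<w₁)
     | forward-elim (toℕ u) (toℕ w₂) (adjacent⇒forward _ _ uw₂ u<w₂)
... | d₁ , w₁≡ , J₁ | d₂ , w₂≡ , J₂ with <-cmp d₁ d₂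
...   | tri< d₁<d₂ _ _ = subst₂ (λ x y → adjacentℕ x y ≡ true) (sym w₁≡) (sym w₂≡)
          (∨-introˡ _ (forward-clique (toℕ u) d₁<d₂ J₁ J₂))
...   | tri≈ _ refl _  = ⊥-elim (w₁≢w₂ (toℕ-injective (trans w₁≡ (sym w₂≡))))
...   | tri> _ _ d₂<d₁ = subst₂ (λ x y → adjacentℕ x y ≡ true) (sym w₁≡) (sym w₂≡)
          (∨-introʳ _ (forward-clique (toℕ u) d₂<d₁ J₂ J₁))

forward-neighbour : ∀ K (u : V (H K)) {j} (j< : j < K * 36) → forward (toℕ u) j ≡ true →
                    ∃[ w ] (u <ᶠ w × adj (H K) u w ≡ true)
forward-neighbour K u j< e =
  fromℕ< j< ,
  subst (toℕ u <_) (sym (toℕ-fromℕ< j<)) (<ᵇ⇒< _ _ (true⇒T (∧-elimˡ e))) ,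
  subst (λ x → adjacentℕ (toℕ u) x ≡ true) (sym (toℕ-fromℕ< j<)) (∨-introˡ _ e)

H-forward : ∀ K → HasForwardNeighbours (H K)
H-forward zero    ()
H-forward (suc k) u 1+u< with next-jump (m%n<n (toℕ u) 36)
... | inj₁ J₁          = forward-neighbour (suc k) u 1+u< (forward-intro 1 (toℕ u) J₁)
... | inj₂ (J₂ , s≢34) = forward-neighbour (suc k) u 2+u< (forward-intro 2 (toℕ u) J₂)
  where
  2+u< : 2 + toℕ u < suc k * 36
  2+u< with m≤n⇒m<n∨m≡n 1+u<
  ... | inj₁ lt   = lt
  ... | inj₂ 2+u≡ = ⊥-elim (s≢34 (trans (cong (_% 36) (suc-injective (suc-injective 2+u≡)))
                                       (%-block k (n≤1+n 35))))

localWithin : ℕ → ℕ → ℕ → Bool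
localWithin zero    s t = s ≡ᵇ t
localWithin (suc r) s t =
  localWithin r s t ∨ any (λ w → adjacentℕ s (toℕ w) ∧ localWithin r (toℕ w) t) (allFin 36)

blockVertex : ∀ {K s q} → s < 36 → q < K → V (H K)
blockVertex s<36 q<K = fromℕ< (block< s<36 q<K)

module _ (K : ℕ) where
  open Walks (H K)

  localWithin-sound : ∀ r {s t q} → q < K → localWithin r s t ≡ true →
    ∀ {u v : V (H K)} → toℕ u ≡ s + q * 36 → toℕ v ≡ t + q * 36 → within (H K) r u v ≡ true
  localWithin-sound zero {s} {t} q<K e {u} {v} u≡ v≡ with ≡ᵇ-sound {s} {t} e
  ... | refl = subst (λ x → within (H K) 0 u x ≡ true) (toℕ-injective (trans u≡ (sym v≡))) (within-refl 0 u)
  localWithin-sound (suc r) {s} {t} {q} q<K e {u} {v} u≡ v≡ with ∨-elim {localWithin r s t} e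
  ... | inj₁ st   = within-suc r (localWithin-sound r q<K st u≡ v≡)
  ... | inj₂ step with any-allFin⁻ (λ w → adjacentℕ s (toℕ w) ∧ localWithin r (toℕ w) t) step
  ...   | w , swt =
    within-step r uw′ (localWithin-sound r q<K (∧-elimʳ {adjacentℕ s (toℕ w)} swt) (toℕ-fromℕ< _) v≡)
    where
    w′ : V (H K)
    w′ = blockVertex (toℕ<n w) q<K
    uw′ : adjacentℕ (toℕ u) (toℕ w′) ≡ true
    uw′ = subst₂ (λ x y → adjacentℕ x y ≡ true) (sym u≡) (sym (toℕ-fromℕ< _))
                 (adjacentℕ-shift q s (toℕ w) (∧-elimˡ swt))

-- Lipschitz potentials and counting by height

-- Block q is raised by (q + 1)·c rather than q·c, so that for c = 27 every height is at least 27
-- and height v ∸ r does not truncate for the radii r ≤ 3 of small-ball.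
level : ℕ → (ℕ → ℕ) → ℕ → ℕ
level c ψ i = suc (i / 36) * c + ψ (i % 36)

level-block : ∀ c ψ {s} q → s < 36 → level c ψ (s + q * 36) ≡ suc q * c + ψ s
level-block c ψ q s<36 = cong₂ (λ a b → suc a * c + ψ b) (/-block q s<36) (%-block q s<36)

level-shift : ∀ c ψ x q → level c ψ (x + q * 36) ≡ q * c + level c ψ x
level-shift c ψ x q = begin
  suc ((x + q * 36) / 36) * c + ψ ((x + q * 36) % 36)
    ≡⟨ cong₂ (λ a b → suc a * c + ψ b) x+q36/36 ([m+kn]%n≡m%n x q 36) ⟩
  (suc (x / 36) + q) * c + ψ (x % 36)
    ≡⟨ cong (_+ ψ (x % 36)) (*-distribʳ-+ c (suc (x / 36)) q) ⟩
  suc (x / 36) * c + q * c + ψ (x % 36)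
    ≡⟨ xy∙z≈y∙xz (suc (x / 36) * c) (q * c) (ψ (x % 36)) ⟩
  q * c + level c ψ x ∎
  where
  open ≡-Reasoning
  x+q36/36 : (x + q * 36) / 36 ≡ x / 36 + q
  x+q36/36 = trans (+-distrib-/-∣ʳ x (divides-refl q)) (cong (x / 36 +_) (m*n/n≡m q 36))

Close : ℕ → ℕ → Set
Close a b = a ≤ suc b × b ≤ suc a

close? : ∀ a b → Dec (Close a b)
close? a b = a ≤? suc b ×-dec b ≤? suc a

Close-+ : ∀ k {a b} → Close a b → Close (k + a) (k + b)
Close-+ k {a} {b} (a≤ , b≤) = subst (k + a ≤_) (+-suc k b) (+-monoʳ-≤ k a≤) ,
                              subst (k + b ≤_) (+-suc k a) (+-monoʳ-≤ k b≤)

LocallyLipschitz : ℕ → (ℕ → ℕ) → Set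
LocallyLipschitz c ψ = ∀ {s} → s < 36 → ∀ {d} → d < 5 → jumps d s ≡ true →
                       Close (level c ψ (d + s)) (level c ψ s)

forward-close : ∀ c ψ → LocallyLipschitz c ψ → ∀ i j → forward i j ≡ true →
                Close (level c ψ j) (level c ψ i)
forward-close c ψ local i j e with forward-elim i j e
... | d , refl , J =
  subst₂ Close (shifted (d + s) (trans (+-assoc d s _) (cong (d +_) i≡))) (shifted s i≡)
    (Close-+ (q * c) (local (m%n<n i 36) (proj₂ (jumps-range d s J)) J))
  where
  s q : ℕ
  s = i % 36
  q = i / 36
  i≡ : s + q * 36 ≡ i
  i≡ = sym (m≡m%n+[m/n]*n i 36)
  shifted : ∀ x {y} → x + q * 36 ≡ y → q * c + level c ψ x ≡ level c ψ y
  shifted x refl = sym (level-shift c ψ x q)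

level-lipschitz : ∀ c ψ → LocallyLipschitz c ψ → ∀ K → Walks.Lipschitz (H K) (λ u → level c ψ (toℕ u))
level-lipschitz c ψ local K u w e with ∨-elim {forward (toℕ u) (toℕ w)} e
... | inj₁ uw = proj₂ (forward-close c ψ local (toℕ u) (toℕ w) uw)
... | inj₂ wu = proj₁ (forward-close c ψ local (toℕ w) (toℕ u) wu)

-- height runs along the chain (sun j at heights 3j to 3j + 2, p_t at 9 + t); skew and hub tell
-- apart vertices of a sun that share a height, which the small radii need.
heightLocal : ℕ → ℕ
heightLocal s = if s <ᵇ 18 then 3 * (s / 6) + lookup (0 ∷ 0 ∷ 0 ∷ 1 ∷ 1 ∷ 2 ∷ []) (s mod 6) else s ∸ 9

skewOffset : ℕ → ℕ
skewOffset s = if s <ᵇ 18 then lookup (2 ∷ 0 ∷ 1 ∷ 0 ∷ 1 ∷ 0 ∷ []) (s mod 6) else 0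

skewLocal : ℕ → ℕ
skewLocal s = heightLocal s + skewOffset s

hubLocal : ℕ → ℕ
hubLocal s = if s <ᵇ 18 then lookup (0 ∷ 2 ∷ 1 ∷ 2 ∷ 1 ∷ 2 ∷ []) (s mod 6) else 2

height skew hub : ℕ → ℕ
height = level 27 heightLocal
skew   = level 27 skewLocal
hub    = level 0 hubLocal

skew≡height+offset : ∀ i → skew i ≡ height i + skewOffset (i % 36)
skew≡height+offset i = sym (+-assoc (suc (i / 36) * 27) (heightLocal (i % 36)) (skewOffset (i % 36)))

hub≡hubLocal : ∀ i → hub i ≡ hubLocal (i % 36)
hub≡hubLocal i = cong (_+ hubLocal (i % 36)) (*-zeroʳ (suc (i / 36)))

opaque
  height-lipschitz : LocallyLipschitz 27 heightLocal
  height-lipschitz = from-yes (allUpTo? (λ s → allUpTo? (λ d →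
    (jumps d s ≟ᵇ true) →-dec close? (height (d + s)) (height s)) 5) 36)

opaque
  skew-lipschitz : LocallyLipschitz 27 skewLocal
  skew-lipschitz = from-yes (allUpTo? (λ s → allUpTo? (λ d →
    (jumps d s ≟ᵇ true) →-dec close? (skew (d + s)) (skew s)) 5) 36)

opaque
  hub-lipschitz : LocallyLipschitz 0 hubLocal
  hub-lipschitz = from-yes (allUpTo? (λ s → allUpTo? (λ d →
    (jumps d s ≟ᵇ true) →-dec close? (hub (d + s)) (hub s)) 5) 36)

opaque
  heightLocal<27 : ∀ {s} → s < 36 → heightLocal s < 27
  heightLocal<27 = from-yes (allUpTo? (λ s → heightLocal s <? 27) 36)

levelProfile : (ℕ → ℕ → Bool) → ℕ → ℕ
levelProfile Q f = ∑[ s < 36 ] 𝟙 (Q (toℕ s) f ∧ (heightLocal (toℕ s) ≡ᵇ f % 27))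

module _ (K : ℕ) where

  height-fibre : ∀ (Q : ℕ → ℕ → Bool) f →
    ∑[ i < K * 36 ] 𝟙 (Q (toℕ i % 36) f ∧ (height (toℕ i) ≡ᵇ f)) ≤ levelProfile Q f
  height-fibre Q f = begin
    ∑[ i < K * 36 ] 𝟙 (Q (toℕ i % 36) f ∧ (height (toℕ i) ≡ᵇ f))
      ≡⟨ ∑-blocks K 36 (λ i → 𝟙 (Q (i % 36) f ∧ (height i ≡ᵇ f))) ⟩
    ∑[ q < K ] ∑[ s < 36 ] 𝟙 (Q ((toℕ s + toℕ q * 36) % 36) f ∧ (height (toℕ s + toℕ q * 36) ≡ᵇ f))
      ≡⟨ sum-cong-≗ {K} (λ q → sum-cong-≗ {36} (λ s → cong₂ (λ x y → 𝟙 (Q x f ∧ (y ≡ᵇ f)))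
           (%-block (toℕ q) (toℕ<n s)) (level-block 27 heightLocal (toℕ q) (toℕ<n s)))) ⟩
    ∑[ q < K ] ∑[ s < 36 ] 𝟙 (atLevel s q)
      ≡⟨ ∑-comm {K} {36} (λ q s → 𝟙 (atLevel s q)) ⟩
    ∑[ s < 36 ] ∑[ q < K ] 𝟙 (atLevel s q)
      ≤⟨ ∑-mono-≤ {36} (λ s → ∑𝟙≤𝟙 {K} (atLevel s) _ (unique s) (at-residue s)) ⟩
    levelProfile Q f ∎
    where
    open ≤-Reasoning
    atLevel : Fin 36 → Fin K → Bool
    atLevel s q = Q (toℕ s) f ∧ (suc (toℕ q) * 27 + heightLocal (toℕ s) ≡ᵇ f)
    at-level : ∀ s q → atLevel s q ≡ true → suc (toℕ q) * 27 + heightLocal (toℕ s) ≡ f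
    at-level s q e = ≡ᵇ-sound (∧-elimʳ {Q (toℕ s) f} e)
    unique : ∀ s q q′ → atLevel s q ≡ true → atLevel s q′ ≡ true → q ≡ q′
    unique s q q′ e e′ = toℕ-injective (suc-injective (*-cancelʳ-≡ _ _ 27
      (+-cancelʳ-≡ _ _ _ (trans (at-level s q e) (sym (at-level s q′ e′))))))
    at-residue : ∀ s q → atLevel s q ≡ true → (Q (toℕ s) f ∧ (heightLocal (toℕ s) ≡ᵇ f % 27)) ≡ true
    at-residue s q e = ∧-intro (∧-elimˡ e) (≡ᵇ-complete (sym (begin-equality
      f % 27                                           ≡⟨ cong (_% 27) (at-level s q e) ⟨
      (suc (toℕ q) * 27 + heightLocal (toℕ s)) % 27     ≡⟨ cong (_% 27) (+-comm (suc (toℕ q) * 27) _) ⟩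
      (heightLocal (toℕ s) + suc (toℕ q) * 27) % 27     ≡⟨ [m+kn]%n≡m%n (heightLocal (toℕ s)) (suc (toℕ q)) 27 ⟩
      heightLocal (toℕ s) % 27                         ≡⟨ m<n⇒m%n≡m (heightLocal<27 (toℕ<n s)) ⟩
      heightLocal (toℕ s)                              ∎)))

  count-by-height : ∀ (P : V (H K) → Bool) (Q : ℕ → ℕ → Bool) a L →
    (∀ u → P u ≡ true → a ≤ height (toℕ u) × height (toℕ u) < a + L ×
                        Q (toℕ u % 36) (height (toℕ u)) ≡ true) →
    ∑[ u < K * 36 ] 𝟙 (P u) ≤ ∑[ t < L ] levelProfile Q (a + toℕ t)
  count-by-height P Q a L located = begin
    ∑[ u < K * 36 ] 𝟙 (P u)                  ≤⟨ ∑-mono-≤ {K * 36} at-height ⟩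
    ∑[ u < K * 36 ] ∑[ t < L ] fibre t u     ≡⟨ ∑-comm {K * 36} {L} (λ u t → fibre t u) ⟩
    ∑[ t < L ] ∑[ u < K * 36 ] fibre t u     ≤⟨ ∑-mono-≤ {L} (λ t → height-fibre Q (a + toℕ t)) ⟩
    ∑[ t < L ] levelProfile Q (a + toℕ t)    ∎
    where
    open ≤-Reasoning
    fibre : Fin L → V (H K) → ℕ
    fibre t u = 𝟙 (Q (toℕ u % 36) (a + toℕ t) ∧ (height (toℕ u) ≡ᵇ a + toℕ t))
    at-height : ∀ u → 𝟙 (P u) ≤ ∑[ t < L ] fibre t u
    at-height u = 𝟙≤ λ Pu →
      let (a≤h , h<a+L , Qu) = located u Pu
          h = height (toℕ u)
          t = fromℕ< (+-cancelˡ-< a (h ∸ a) L (subst (_< a + L) (sym (m+[n∸m]≡n a≤h)) h<a+L))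
          a+t≡h : a + toℕ t ≡ h
          a+t≡h = trans (cong (a +_) (toℕ-fromℕ< _)) (m+[n∸m]≡n a≤h)
      in ≤-trans (≤-reflexive (sym (subst (λ x → 𝟙 (Q (toℕ u % 36) x ∧ (h ≡ᵇ x)) ≡ 1) (sym a+t≡h)
                                          (𝟙-true (∧-intro Qu (≡ᵇ-complete {h} refl))))))
                 (term≤∑ (λ t → fibre t u) t)

∑-blockPeriodic : ∀ K (g : ℕ → ℕ) → ∑[ i < K * 36 ] g (toℕ i % 36) ≡ K * ∑[ s < 36 ] g (toℕ s)
∑-blockPeriodic K g = begin
  ∑[ i < K * 36 ] g (toℕ i % 36)                         ≡⟨ ∑-blocks K 36 (λ i → g (i % 36)) ⟩
  ∑[ q < K ] ∑[ s < 36 ] g ((toℕ s + toℕ q * 36) % 36)   ≡⟨ sum-cong-≗ {K} (λ q → sum-cong-≗ {36}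
                                                              (λ s → cong g (%-block (toℕ q) (toℕ<n s)))) ⟩
  ∑[ q < K ] ∑[ s < 36 ] g (toℕ s)                       ≡⟨ ∑-const K _ ⟩
  K * ∑[ s < 36 ] g (toℕ s)                              ∎
  where open ≡-Reasoning

near⇒window : ∀ {x y} r → x ≤ y + r → y ≤ x + r → y ∸ r ≤ x × x < y ∸ r + suc (r + r)
near⇒window {x} {y} r x≤y+r y≤x+r = subst (y ∸ r ≤_) (m+n∸n≡m x r) (∸-monoˡ-≤ r y≤x+r) , (begin-strict
  x                       ≤⟨ x≤y+r ⟩
  y + r                   ≤⟨ +-monoˡ-≤ r (m≤n+m∸n y r) ⟩
  r + (y ∸ r) + r         ≡⟨ cong (_+ r) (+-comm r (y ∸ r)) ⟩
  (y ∸ r) + r + r         ≡⟨ +-assoc (y ∸ r) r r ⟩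
  (y ∸ r) + (r + r)       <⟨ +-monoʳ-< (y ∸ r) (n<1+n (r + r)) ⟩
  (y ∸ r) + suc (r + r)   ∎)
  where open ≤-Reasoning

module _ (K : ℕ) where
  open Walks (H K)

  ball-heights : ∀ r {u v} → within (H K) r u v ≡ true →
    height (toℕ v) ∸ r ≤ height (toℕ u) × height (toℕ u) < height (toℕ v) ∸ r + suc (r + r)
  ball-heights r uv =
    let (≤v+r , ≤u+r) = within-lipschitz (level-lipschitz 27 heightLocal height-lipschitz K) r uv
    in near⇒window r ≤v+r ≤u+r

profile : (ℕ → Bool) → ℕ → ℕ
profile S = levelProfile (λ s _ → S s)

profile-mod : ∀ S f → profile S (f % 27) ≡ profile S f
profile-mod S f =
  sum-cong-≗ {36} (λ s → cong (λ x → 𝟙 (S (toℕ s) ∧ (heightLocal (toℕ s) ≡ᵇ x))) (m%n%n≡m%n f 27))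

ball-count : ∀ K (S : ℕ → Bool) (p : ℕ → ℕ) → (∀ {x} → x < 27 → profile S x ≡ p x) → ∀ v r →
  ∑[ u < K * 36 ] 𝟙 (within (H K) r u v ∧ S (toℕ u % 36))
    ≤ Periodic.windowSum 27 p (height (toℕ v) ∸ r) (suc (r + r))
ball-count K S p tabulated v r = begin
  ∑[ u < K * 36 ] 𝟙 (within (H K) r u v ∧ S (toℕ u % 36))
    ≤⟨ count-by-height K _ (λ s _ → S s) a (suc (r + r)) located ⟩
  ∑[ t < suc (r + r) ] profile S (a + toℕ t)
    ≡⟨ sum-cong-≗ {suc (r + r)} (λ t →
         trans (sym (profile-mod S (a + toℕ t))) (tabulated (m%n<n (a + toℕ t) 27))) ⟩
  Periodic.windowSum 27 p a (suc (r + r)) ∎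
  where
  open ≤-Reasoning
  a : ℕ
  a = height (toℕ v) ∸ r
  located : ∀ u → (within (H K) r u v ∧ S (toℕ u % 36)) ≡ true →
            a ≤ height (toℕ u) × height (toℕ u) < a + suc (r + r) × S (toℕ u % 36) ≡ true
  located u e = let (a≤ , <a+L) = ball-heights K r (∧-elimˡ e) in a≤ , <a+L , ∧-elimʳ {within (H K) r u v} e

fromTable : Vec ℕ 27 → ℕ → ℕ
fromTable T x = lookup T (x mod 27)

-- Multipackings of H K

inM : ℕ → Bool
inM s = does (s ∈? (1 ∷ 7 ∷ 13 ∷ 18 ∷ 21 ∷ 24 ∷ 27 ∷ 30 ∷ 33 ∷ []))

profileM : ℕ → ℕ
profileM = fromTable (1 ∷ 0 ∷ 0 ∷ 1 ∷ 0 ∷ 0 ∷ 1 ∷ 0 ∷ 0 ∷ 1 ∷ 0 ∷ 0 ∷ 1 ∷ 0 ∷ 0 ∷ 1 ∷ 0 ∷ 0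
                      ∷ 1 ∷ 0 ∷ 0 ∷ 1 ∷ 0 ∷ 0 ∷ 1 ∷ 0 ∷ 0 ∷ [])

opaque
  profileM-tabulated : ∀ {x} → x < 27 → profile inM x ≡ profileM x
  profileM-tabulated = from-yes (allUpTo? (λ x → profile inM x ≟ profileM x) 27)

module PM = Periodic 27 profileM

opaque
  profileM-period : ∀ {a} → a < 27 → PM.windowSum a 27 ≤ 9
  profileM-period = from-yes (allUpTo? (λ a → PM.windowSum a 27 ≤? 9) 27)

opaque
  profileM-base : ∀ {a} → a < 27 → ∀ {x} → x < 27 → 2 * PM.windowSum a (3 + x) + 0 ≤ 3 + x
  profileM-base = from-yes (allUpTo? (λ a → allUpTo? (λ x → 2 * PM.windowSum a (3 + x) + 0 ≤? 3 + x) 27) 27)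

2*m≤1+n+n⇒m≤n : ∀ {m n} → 2 * m + 0 ≤ suc (n + n) → m ≤ n
2*m≤1+n+n⇒m≤n {m} {n} 2m≤ with m ≤? n
... | yes m≤n = m≤n
... | no  m≰n = ⊥-elim (<-irrefl refl (begin-strict
  suc (n + n)        <⟨ n<1+n _ ⟩
  suc (suc (n + n))  ≡⟨ cong suc (+-suc n n) ⟨
  suc n + suc n      ≤⟨ +-mono-≤ n<m n<m ⟩
  m + m              ≡⟨ cong (m +_) (+-identityʳ m) ⟨
  2 * m              ≡⟨ +-identityʳ (2 * m) ⟨
  2 * m + 0          ≤⟨ 2m≤ ⟩
  suc (n + n)        ∎))
  where
  open ≤-Reasoning
  n<m : n < m
  n<m = ≰⇒> m≰n

module _ (K : ℕ) where

  Mset : Subset (K * 36)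
  Mset = tabulate (λ u → inM (toℕ u % 36))

  Mset-size : ∣ Mset ∣ ≡ 9 * K
  Mset-size = trans (∣tabulate∣ {K * 36} (λ u → inM (toℕ u % 36)))
                    (trans (∑-blockPeriodic K (𝟙 ∘ inM)) (*-comm K 9))

  Mset-multipacking : IsMultipacking (H K) Mset
  Mset-multipacking v r 1≤r = begin
    ∣ ball (H K) r v ∩ Mset ∣
      ≡⟨ ∣ball∩tabulate∣ (H K) r v (λ u → inM (toℕ u % 36)) ⟩
    ∑[ u < K * 36 ] 𝟙 (within (H K) r u v ∧ inM (toℕ u % 36))
      ≤⟨ ball-count K inM profileM profileM-tabulated v r ⟩
    PM.windowSum (height (toℕ v) ∸ r) (suc (r + r))
      ≤⟨ 2*m≤1+n+n⇒m≤n (PM.windowSum-bound 2 0 profileM-period (m≤m+n 18 9) 3 profileM-base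
                       (height (toℕ v) ∸ r) (suc (r + r)) (s≤s (+-mono-≤ 1≤r 1≤r))) ⟩
    r ∎
    where open ≤-Reasoning

-- The groups are the three suns and the six triples p_3i, p_3i+1, p_3i+2 of the path.
group : ℕ → ℕ
group s = if s <ᵇ 18 then s / 6 else 3 + (s ∸ 18) / 3

opaque
  group<9 : ∀ {s} → s < 36 → group s < 9
  group<9 = from-yes (allUpTo? (λ s → group s <? 9) 36)

opaque
  group-clustered : ∀ {s₁} → s₁ < 36 → ∀ {s₂} → s₂ < 36 → group s₁ ≡ group s₂ → s₁ ≢ s₂ →
    ∃[ c ] (c < 36 × localWithin 1 s₁ c ≡ true × localWithin 1 s₂ c ≡ true)
  group-clustered = from-yes (allUpTo? (λ s₁ → allUpTo? (λ s₂ →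
    (group s₁ ≟ group s₂) →-dec ¬? (s₁ ≟ s₂) →-dec
    anyUpTo? (λ c → (localWithin 1 s₁ c ≟ᵇ true) ×-dec (localWithin 1 s₂ c ≟ᵇ true)) 36) 36) 36)

module _ (K : ℕ) where

  globalGroup : V (H K) → ℕ
  globalGroup u = group (toℕ u % 36) + (toℕ u / 36) * 9

  globalGroup< : ∀ u → globalGroup u < K * 9
  globalGroup< u = block< {K = K} (group<9 (m%n<n (toℕ u) 36)) (m<n*o⇒m/o<n (toℕ<n u))

  multipacking-one-per-group : ∀ {M} → IsMultipacking (H K) M → ∀ u w →
    globalGroup u ≡ globalGroup w → lookup M u ≡ true → lookup M w ≡ true → u ≡ w
  multipacking-one-per-group {M} multipacking u w same Mu Mw = by-offset (s₁ ≟ s₂)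
    where
    s₁ s₂ q q′ : ℕ
    s₁ = toℕ u % 36
    s₂ = toℕ w % 36
    q  = toℕ u / 36
    q′ = toℕ w / 36
    q<K : q < K
    q<K = m<n*o⇒m/o<n (toℕ<n u)
    q≡q′ : q ≡ q′
    q≡q′ = trans (sym (/-block q (group<9 (m%n<n (toℕ u) 36))))
           (trans (cong (_/ 9) same) (/-block q′ (group<9 (m%n<n (toℕ w) 36))))
    g≡g′ : group s₁ ≡ group s₂
    g≡g′ = trans (sym (%-block q (group<9 (m%n<n (toℕ u) 36))))
           (trans (cong (_% 9) same) (%-block q′ (group<9 (m%n<n (toℕ w) 36))))
    u≡ : toℕ u ≡ s₁ + q * 36
    u≡ = m≡m%n+[m/n]*n (toℕ u) 36
    w≡ : toℕ w ≡ s₂ + q * 36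
    w≡ = trans (m≡m%n+[m/n]*n (toℕ w) 36) (cong (λ x → s₂ + x * 36) (sym q≡q′))
    by-offset : Dec (s₁ ≡ s₂) → u ≡ w
    by-offset (yes s₁≡s₂) = toℕ-injective (trans u≡ (trans (cong (_+ q * 36) s₁≡s₂) (sym w≡)))
    by-offset (no s₁≢s₂) with group-clustered (m%n<n (toℕ u) 36) (m%n<n (toℕ w) 36) g≡g′ s₁≢s₂
    ... | c , c<36 , s₁c , s₂c =
      multipacking-closedNeighbourhood (H K) multipacking Mu Mw
        (localWithin-sound K 1 q<K s₁c u≡ (toℕ-fromℕ< (block< c<36 q<K)))
        (localWithin-sound K 1 q<K s₂c w≡ (toℕ-fromℕ< (block< c<36 q<K)))

  multipacking≤9K : ∀ M → IsMultipacking (H K) M → ∣ M ∣ ≤ 9 * K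
  multipacking≤9K M multipacking = begin
    ∣ M ∣                                        ≡⟨ ∣subset∣ M ⟩
    ∑[ u < K * 36 ] 𝟙 (lookup M u)               ≤⟨ ∑-mono-≤ {K * 36} in-own-group ⟩
    ∑[ u < K * 36 ] ∑[ g < K * 9 ] member g u    ≡⟨ ∑-comm {K * 36} {K * 9} (λ u g → member g u) ⟩
    ∑[ g < K * 9 ] ∑[ u < K * 36 ] member g u    ≤⟨ ∑-mono-≤ {K * 9} (λ g → ∑𝟙≤1 (inGroup g) (unique g)) ⟩
    ∑[ g < K * 9 ] 1                             ≡⟨ ∑-const (K * 9) 1 ⟩
    K * 9 * 1                                    ≡⟨ *-identityʳ (K * 9) ⟩
    K * 9                                        ≡⟨ *-comm K 9 ⟩
    9 * K                                        ∎
    where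
    open ≤-Reasoning
    inGroup : Fin (K * 9) → V (H K) → Bool
    inGroup g u = (globalGroup u ≡ᵇ toℕ g) ∧ lookup M u
    member : Fin (K * 9) → V (H K) → ℕ
    member g u = 𝟙 (inGroup g u)
    in-own-group : ∀ u → 𝟙 (lookup M u) ≤ ∑[ g < K * 9 ] member g u
    in-own-group u = 𝟙≤ λ Mu → ≤-trans
      (≤-reflexive (sym (𝟙-true (∧-intro (≡ᵇ-complete (sym (toℕ-fromℕ< (globalGroup< u)))) Mu))))
      (term≤∑ (λ g → member g u) (fromℕ< (globalGroup< u)))
    unique : ∀ g u w → inGroup g u ≡ true → inGroup g w ≡ true → u ≡ w
    unique g u w e e′ = multipacking-one-per-group multipacking u w
      (trans (≡ᵇ-sound (∧-elimˡ e)) (sym (≡ᵇ-sound (∧-elimˡ e′))))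
      (∧-elimʳ {globalGroup u ≡ᵇ toℕ g} e) (∧-elimʳ {globalGroup w ≡ᵇ toℕ g} e′)

-- Dominating broadcasts of H K

broadcastLocal : ℕ → ℕ
broadcastLocal s =
  if s ≡ᵇ 9 then 2 else if does (s ∈? (2 ∷ 16 ∷ 19 ∷ 22 ∷ 25 ∷ 28 ∷ 31 ∷ 34 ∷ [])) then 1 else 0

opaque
  heard-locally : ∀ {s} → s < 36 →
    ∃[ c ] (c < 36 × 0 < broadcastLocal c × localWithin (broadcastLocal c) s c ≡ true)
  heard-locally = from-yes (allUpTo? (λ s → anyUpTo? (λ c →
    (0 <? broadcastLocal c) ×-dec (localWithin (broadcastLocal c) s c ≟ᵇ true)) 36) 36)

opaque
  broadcastLocal≤2 : ∀ {s} → s < 36 → broadcastLocal s ≤ 2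
  broadcastLocal≤2 = from-yes (allUpTo? (λ s → broadcastLocal s ≤? 2) 36)

module _ (K : ℕ) where
  open Walks (H K)

  broadcast : V (H K) → ℕ
  broadcast u = broadcastLocal (toℕ u % 36)

  broadcast-cost : cost (H K) broadcast ≡ 10 * K
  broadcast-cost = trans (cost≡∑ (H K) broadcast) (trans (∑-blockPeriodic K broadcastLocal) (*-comm K 10))

  broadcast-dominates : ∀ u → ∃[ v ] (0 < broadcast v × within (H K) (broadcast v) u v ≡ true)
  broadcast-dominates u = hear (heard-locally (m%n<n (toℕ u) 36))
    where
    q<K : toℕ u / 36 < K
    q<K = m<n*o⇒m/o<n (toℕ<n u)
    hear : ∃[ c ] (c < 36 × 0 < broadcastLocal c × localWithin (broadcastLocal c) (toℕ u % 36) c ≡ true) →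
           ∃[ v ] (0 < broadcast v × within (H K) (broadcast v) u v ≡ true)
    hear (c , c<36 , 0<bc , uc) =
      v , subst (0 <_) (sym v-power) 0<bc ,
      subst (λ r → within (H K) r u v ≡ true) (sym v-power)
        (localWithin-sound K (broadcastLocal c) q<K uc (m≡m%n+[m/n]*n (toℕ u) 36) (toℕ-fromℕ< _))
      where
      v : V (H K)
      v = blockVertex c<36 q<K
      v-power : broadcast v ≡ broadcastLocal c
      v-power = cong broadcastLocal
        (trans (cong (_% 36) (toℕ-fromℕ< (block< c<36 q<K))) (%-block (toℕ u / 36) c<36))

diam≥9 : ∀ k D → IsDiam (H (suc k)) D → 9 ≤ D
diam≥9 k D (all-within , _) =
  +-cancelˡ-≤ 27 9 D (proj₂ (within-lipschitz height-lipschitz′ D (all-within v₀ v₁₈)))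
  where
  open Walks (H (suc k))
  height-lipschitz′ : Lipschitz (λ u → height (toℕ u))
  height-lipschitz′ = level-lipschitz 27 heightLocal height-lipschitz (suc k)
  v₀ v₁₈ : V (H (suc k))
  v₀  = fromℕ< {0}  (s≤s z≤n)
  v₁₈ = fromℕ< {18} (m≤m+n 19 _)

broadcast-dominating : ∀ k → IsDominatingBroadcast (H (suc k)) (broadcast (suc k))
broadcast-dominating k =
  (λ D diam v → ≤-trans (broadcastLocal≤2 (m%n<n (toℕ v) 36)) (≤-trans (m≤m+n 2 7) (diam≥9 k D diam))) ,
  broadcast-dominates (suc k)

inW : ℕ → Bool
inW s = does (s ∈? (0 ∷ 1 ∷ 5 ∷ 6 ∷ 7 ∷ 11 ∷ 14 ∷ 16 ∷ 18 ∷ 19 ∷ 21 ∷ 22 ∷ 24 ∷ 25 ∷ 27 ∷ 28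
                    ∷ 30 ∷ 31 ∷ 33 ∷ 34 ∷ []))

profileW : ℕ → ℕ
profileW = fromTable (2 ∷ 0 ∷ 1 ∷ 2 ∷ 0 ∷ 1 ∷ 1 ∷ 1 ∷ 0 ∷ 1 ∷ 1 ∷ 0 ∷ 1 ∷ 1 ∷ 0 ∷ 1 ∷ 1 ∷ 0
                      ∷ 1 ∷ 1 ∷ 0 ∷ 1 ∷ 1 ∷ 0 ∷ 1 ∷ 1 ∷ 0 ∷ [])

module PW = Periodic 27 profileW

opaque
  profileW-tabulated : ∀ {x} → x < 27 → profile inW x ≡ profileW x
  profileW-tabulated = from-yes (allUpTo? (λ x → profile inW x ≟ profileW x) 27)

  profileW-period : ∀ {a} → a < 27 → PW.windowSum a 27 ≤ 20
  profileW-period = from-yes (allUpTo? (λ a → PW.windowSum a 27 ≤? 20) 27)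

  profileW-base : ∀ {a} → a < 27 → ∀ {x} → x < 27 → 1 * PW.windowSum a (9 + x) + 1 ≤ 9 + x
  profileW-base = from-yes (allUpTo? (λ a → allUpTo? (λ x → 1 * PW.windowSum a (9 + x) + 1 ≤? 9 + x) 27) 27)

near : ℕ → ℕ → ℕ → Bool
near r x y = (x ≤ᵇ y + r) ∧ (y ≤ᵇ x + r)

nearInW : ℕ → ℕ → ℕ → ℕ → ℕ → Bool
nearInW r skewᵥ hubᵥ s f = inW s ∧ near r (f + skewOffset s) skewᵥ ∧ near r (hubLocal s) hubᵥ

-- Bounds |N_r[v] ∩ W| for every v whose local vertex is sv (see small-ball).
smallBallCount : ℕ → ℕ → ℕ
smallBallCount sv r = ∑[ t < suc (r + r) ] ∑[ s < 36 ]
  𝟙 (nearInW r (r + skewOffset sv) (hubLocal sv) (toℕ s) (toℕ t)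
     ∧ (heightLocal (toℕ s) ≡ᵇ (27 + heightLocal sv ∸ r + toℕ t) % 27))

opaque
  smallBallCount≤2r : ∀ {sv} → sv < 36 → ∀ {r} → r < 4 → 1 ≤ r → smallBallCount sv r ≤ r + r
  smallBallCount≤2r = from-yes (allUpTo? (λ sv → allUpTo? (λ r →
    (1 ≤? r) →-dec smallBallCount sv r ≤? r + r) 4) 36)

near-shift : ∀ r a x y → near r (a + x) (a + y) ≡ near r x y
near-shift r a x y = cong₂ _∧_ (trans (cong (a + x ≤ᵇ_) (+-assoc a y r)) (≤ᵇ-shift a x (y + r)))
                                (trans (cong (a + y ≤ᵇ_) (+-assoc a x r)) (≤ᵇ-shift a y (x + r)))

near-intro : ∀ {r x y} → x ≤ y + r → y ≤ x + r → near r x y ≡ true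
near-intro x≤ y≤ = ∧-intro (≤ᵇ-complete x≤) (≤ᵇ-complete y≤)

module _ (i r : ℕ) (r≤27 : r ≤ 27) where

  height∸r≡ : height i ∸ r ≡ 27 + heightLocal (i % 36) ∸ r + i / 36 * 27
  height∸r≡ = trans (cong (_∸ r) (xy∙z≈xz∙y 27 (i / 36 * 27) (heightLocal (i % 36))))
                    (+-∸-comm (i / 36 * 27) (≤-trans r≤27 (m≤m+n 27 (heightLocal (i % 36)))))

  skew≡ : skew i ≡ height i ∸ r + (r + skewOffset (i % 36))
  skew≡ = trans (skew≡height+offset i)
            (trans (cong (_+ skewOffset (i % 36)) (sym (m∸n+n≡m r≤height)))
                   (+-assoc (height i ∸ r) r (skewOffset (i % 36))))
    where
    r≤height : r ≤ height i
    r≤height = ≤-trans r≤27 (≤-trans (m≤m+n 27 (i / 36 * 27)) (m≤m+n (suc (i / 36) * 27) _))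

  nearInW-relative : ∀ s t → nearInW r (skew i) (hub i) s (height i ∸ r + t)
                           ≡ nearInW r (r + skewOffset (i % 36)) (hubLocal (i % 36)) s t
  nearInW-relative s t = cong₂ (λ x y → inW s ∧ x ∧ y)
    (trans (cong₂ (near r) (+-assoc (height i ∸ r) t (skewOffset s)) skew≡)
           (near-shift r (height i ∸ r) (t + skewOffset s) _))
    (cong (near r (hubLocal s)) (hub≡hubLocal i))

  height-residue : ∀ t → (height i ∸ r + t) % 27 ≡ (27 + heightLocal (i % 36) ∸ r + t) % 27
  height-residue t = trans (cong (λ x → (x + t) % 27) height∸r≡)
    (trans (cong (_% 27) (xy∙z≈xz∙y (27 + heightLocal (i % 36) ∸ r) (i / 36 * 27) t))
           ([m+kn]%n≡m%n (27 + heightLocal (i % 36) ∸ r + t) (i / 36) 27))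

module _ (K : ℕ) where
  open Walks (H K)

  near-in-ball : ∀ (φ : ℕ → ℕ) → Lipschitz (λ u → φ (toℕ u)) → ∀ r {u v} → within (H K) r u v ≡ true →
                 near r (φ (toℕ u)) (φ (toℕ v)) ≡ true
  near-in-ball φ lip r uv = let (≤v , ≤u) = within-lipschitz lip r uv in near-intro ≤v ≤u

  in-ball⇒nearInW : ∀ r {u v} → within (H K) r u v ≡ true → inW (toℕ u % 36) ≡ true →
                    nearInW r (skew (toℕ v)) (hub (toℕ v)) (toℕ u % 36) (height (toℕ u)) ≡ true
  in-ball⇒nearInW r {u} {v} uv u∈W = ∧-intro u∈W (∧-intro
    (subst (λ x → near r x (skew (toℕ v)) ≡ true) (skew≡height+offset (toℕ u))
           (near-in-ball skew (level-lipschitz 27 skewLocal skew-lipschitz K) r uv))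
    (subst (λ x → near r x (hub (toℕ v)) ≡ true) (hub≡hubLocal (toℕ u))
           (near-in-ball hub (level-lipschitz 0 hubLocal hub-lipschitz K) r uv)))

  small-ball : ∀ v r → 1 ≤ r → r < 4 → ∑[ u < K * 36 ] 𝟙 (within (H K) r u v ∧ inW (toℕ u % 36)) ≤ r + r
  small-ball v r 1≤r r<4 = begin
    ∑[ u < K * 36 ] 𝟙 (within (H K) r u v ∧ inW (toℕ u % 36))
      ≤⟨ count-by-height K _ Q a (suc (r + r)) located ⟩
    ∑[ t < suc (r + r) ] levelProfile Q (a + toℕ t)
      ≡⟨ sum-cong-≗ {suc (r + r)} (λ t → sum-cong-≗ {36} (λ s → cong 𝟙 (cong₂ _∧_
           (nearInW-relative (toℕ v) r r≤27 (toℕ s) (toℕ t))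
           (cong (heightLocal (toℕ s) ≡ᵇ_) (height-residue (toℕ v) r r≤27 (toℕ t)))))) ⟩
    smallBallCount (toℕ v % 36) r
      ≤⟨ smallBallCount≤2r (m%n<n (toℕ v) 36) r<4 1≤r ⟩
    r + r ∎
    where
    open ≤-Reasoning
    a : ℕ
    a = height (toℕ v) ∸ r
    Q : ℕ → ℕ → Bool
    Q = nearInW r (skew (toℕ v)) (hub (toℕ v))
    r≤27 : r ≤ 27
    r≤27 = ≤-trans (<⇒≤ r<4) (m≤m+n 4 23)
    located : ∀ u → (within (H K) r u v ∧ inW (toℕ u % 36)) ≡ true →
              a ≤ height (toℕ u) × height (toℕ u) < a + suc (r + r) × Q (toℕ u % 36) (height (toℕ u)) ≡ true
    located u e = let (a≤ , <a+L) = ball-heights K r (∧-elimˡ e)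
                  in a≤ , <a+L , in-ball⇒nearInW r (∧-elimˡ e) (∧-elimʳ {within (H K) r u v} e)

  big-ball : ∀ v r → 4 ≤ r → ∑[ u < K * 36 ] 𝟙 (within (H K) r u v ∧ inW (toℕ u % 36)) ≤ r + r
  big-ball v r 4≤r = begin
    ∑[ u < K * 36 ] 𝟙 (within (H K) r u v ∧ inW (toℕ u % 36))
      ≤⟨ ball-count K inW profileW profileW-tabulated v r ⟩
    S
      ≤⟨ ≤-pred (subst (_≤ suc (r + r)) S+1≡ bound) ⟩
    r + r ∎
    where
    open ≤-Reasoning
    S : ℕ
    S = PW.windowSum (height (toℕ v) ∸ r) (suc (r + r))
    bound : 1 * S + 1 ≤ suc (r + r)
    bound = PW.windowSum-bound 1 1 profileW-period (m≤m+n 20 7) 9 profileW-base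
              (height (toℕ v) ∸ r) (suc (r + r)) (s≤s (+-mono-≤ 4≤r 4≤r))
    S+1≡ : 1 * S + 1 ≡ suc S
    S+1≡ = trans (cong (_+ 1) (*-identityˡ S)) (+-comm S 1)

  W-ball-bound : ∀ v r → 1 ≤ r → ∑[ u < K * 36 ] 𝟙 (within (H K) r u v ∧ inW (toℕ u % 36)) ≤ 2 * r
  W-ball-bound v r 1≤r = ≤-trans (by-radius (r <? 4)) (≤-reflexive (cong (r +_) (sym (+-identityʳ r))))
    where
    by-radius : Dec (r < 4) → ∑[ u < K * 36 ] 𝟙 (within (H K) r u v ∧ inW (toℕ u % 36)) ≤ r + r
    by-radius (yes r<4) = small-ball v r 1≤r r<4
    by-radius (no r≮4)  = big-ball v r (≮⇒≥ r≮4)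

  broadcast≥10K : ∀ f → IsDominatingBroadcast (H K) f → 10 * K ≤ cost (H K) f
  broadcast≥10K f dominating = *-cancelˡ-≤ 2 (begin
    2 * (10 * K)                             ≡⟨ *-assoc 2 10 K ⟨
    20 * K                                   ≡⟨ *-comm 20 K ⟩
    K * 20                                   ≡⟨ ∑-blockPeriodic K (𝟙 ∘ inW) ⟨
    ∑[ u < K * 36 ] 𝟙 (inW (toℕ u % 36))     ≤⟨ broadcast-cost-lower-bound (H K) (λ u → inW (toℕ u % 36)) 2
                                                  W-ball-bound f dominating ⟩
    2 * cost (H K) f                         ∎)
    where open ≤-Reasoning

mainTheorem9 : (k : ℕ) → ∃[ H ] (Connected H × Chordal H
    × MultipackingNumber H (9 * suc k) × BroadcastDominationNumber H (10 * suc k))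
mainTheorem9 k =
  H K ,
  forward⇒connected (H K) (H-forward K) ,
  peo⇒chordal (H-peo K) ,
  ((Mset K , Mset-multipacking K , Mset-size K) , multipacking≤9K K) ,
  ((broadcast K , broadcast-dominating k , broadcast-cost K) , broadcast≥10K K)
  where
  K : ℕ
  K = suc k
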